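{- For every $\sigma\in\mathfrak{S}_n$, $\mathrm{st}(\mathrm{HAN}\text{ -code}(\sigma))=\mathrm{exc}(\sigma)$.
   Context: $\mathfrak{S}_n$ is the set of permutations of $\{1,\dots,n\}$, written as words $\sigma=\sigma_1\cdots\sigma_n$. An excedance of $\sigma$ is an index $j$ with $\sigma_j>j$, and $\sigma_j$ is then an excedance top; $\mathrm{exc}(\sigma)$ is the number of excedances. Han's map $\Psi:\mathfrak{S}_{n-1}\times\{0,1,\dots,n-1\}\to\mathfrak{S}_n$ ($n\ge2$) is defined as follows. If $s=0$, $\Psi(\sigma,0)=\sigma_1\cdots\sigma_{n-1}n$. If $s\ge1$: define a bijection $\nu$ from the values $\{1,\dots,n-1\}$ to $\{1,\dots,n-1\}$ by letting $\nu$ assign $1,2,\dots,\mathrm{exc}(\sigma)$ to the excedance tops of $\sigma$ in decreasing order of value, and $\mathrm{exc}(\sigma)+1,\dots,n-1$ to the non-excedance tops of $\sigma$ in increasing order of value. Let $v=\nu^{ -1}(s)$. Let $a_1>a_2>\cdots>a_m$ ($m\ge0$) be the excedance tops of $\sigma$ that are $\ge v$, and set $a_0=n$. For $i=1,\dots,m$ replace the letter $a_i$ in $\sigma$ by $a_{i-1}$ (in the same position), and then insert the letter $a_m$ so that it occupies position $v$ (shifting later letters one place to the right); the resulting word is $\Psi(\sigma,s)$. (For example $\Psi(341625,2)=3614725$, $\Psi(341625,5)=4361725$, $\Psi(1,1)=21$.) By a theorem of Han, the map $E_n\to\mathfrak{S}_n$ sending $(e_1,\dots,e_n)$ (where necessarily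 $e_1=0$) to $\Psi(\cdots\Psi(\Psi(1,e_2),e_3)\cdots,e_n)$ is a bijection, where $E_n$ is the set of integer $n$-tuples with $0\le e_j\le j-1$; $\mathrm{HAN}\text{ -code}(\sigma)\in E_n$ is the preimage of $\sigma$ under this bijection. For an integer tuple $(e_1,\dots,e_n)$, $\mathrm{st}$ is the largest $\ell\ge0$ such that there exist indices $j_1<\cdots<j_\ell$ with $e_{j_k}\ge k$ for $1\le k\le\ell$. -}

module Defs where

open import Data.Nat using (ℕ; zero; suc; _+_; _∸_; _≤_; _<_; _<ᵇ_; _≤ᵇ_; _≡ᵇ_)
open import Data.Bool using (Bool; true; false; if_then_else_; not)
open import Data.List using (List; []; _∷_; _++_; length; map; filter; foldl; take; drop; upTo; downFrom)
open import Data.Product using (_×_)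
open import Data.Unit using (⊤)
open import Relation.Nullary.Decidable using (T?)
open import Data.Bool using (T)
open import Relation.Binary.PropositionalEquality using (_≡_; refl)
open import Data.List.Relation.Binary.Permutation.Propositional using (_↭_)

-- Permutations are words: lists of naturals (σ₁ ⋯ σₙ), positions 1-indexed.

excTopsFrom : ℕ → List ℕ → List ℕ
excTopsFrom j [] = []
excTopsFrom j (x ∷ xs) = if j <ᵇ x then x ∷ excTopsFrom (suc j) xs else excTopsFrom (suc j) xs

excTops : List ℕ → List ℕ
excTops = excTopsFrom 1

excFrom : ℕ → List ℕ → ℕ
excFrom j [] = 0
excFrom j (x ∷ xs) = (if j <ᵇ x then 1 else 0) + excFrom (suc j) xs

exc : List ℕ → ℕ
exc = excFrom 1

memb : ℕ → List ℕ → Bool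
memb x [] = false
memb x (y ∷ ys) = if x ≡ᵇ y then true else memb x ys

descTo1 : ℕ → List ℕ
descTo1 k = map suc (downFrom k)

ascFrom1 : ℕ → List ℕ
ascFrom1 k = map suc (upTo k)

-- 1-indexed lookup with default 0
nth : ℕ → List ℕ → ℕ
nth _ [] = 0
nth zero (x ∷ _) = x          -- (index 0 treated as 1; never used)
nth (suc zero) (x ∷ _) = x
nth (suc (suc k)) (_ ∷ xs) = nth (suc k) xs

last : ℕ → List ℕ → ℕ
last d [] = d
last d (x ∷ xs) = last x xs

assoc : ℕ → List ℕ → List ℕ → ℕ
assoc x [] _ = x
assoc x (_ ∷ _) [] = x
assoc x (a ∷ as) (b ∷ bs) = if x ≡ᵇ a then b else assoc x as bs

-- Han's map Ψ : 𝔖_{n-1} × {0,…,n-1} → 𝔖_n, with n = length σ + 1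
Ψ : List ℕ → ℕ → List ℕ
Ψ σ zero = σ ++ (suc (length σ) ∷ [])
Ψ σ (suc s) = take (v ∸ 1) σ' ++ (aₘ ∷ drop (v ∸ 1) σ')
  where
  n : ℕ
  n = suc (length σ)
  tops : List ℕ
  tops = excTops σ
  isTop : ℕ → Bool
  isTop x = memb x tops
  -- ν⁻¹ as a list: ν⁻¹(1), ν⁻¹(2), …, ν⁻¹(n-1)
  order : List ℕ
  order = filter (λ x → T? (isTop x)) (descTo1 (length σ))
       ++ filter (λ x → T? (not (isTop x))) (ascFrom1 (length σ))
  v : ℕ
  v = nth (suc s) order
  -- a₁ > a₂ > ⋯ > aₘ : excedance tops ≥ v
  as : List ℕ
  as = filter (λ x → T? (v ≤ᵇ x)) (filter (λ x → T? (isTop x)) (descTo1 (length σ)))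
  aₘ : ℕ
  aₘ = last n as
  σ' : List ℕ
  σ' = map (λ x → assoc x as (n ∷ as)) σ

-- Han's composite map E_n → 𝔖_n : (e₁,…,eₙ) ↦ Ψ(⋯Ψ(Ψ(1,e₂),e₃)⋯,eₙ)
hanMap : List ℕ → List ℕ
hanMap [] = []
hanMap (_ ∷ es) = foldl Ψ (1 ∷ []) es

BoundedFrom : ℕ → List ℕ → Set
BoundedFrom j [] = ⊤
BoundedFrom j (e ∷ es) = e < j × BoundedFrom (suc j) es

InE : ℕ → List ℕ → Set
InE n e = length e ≡ n × BoundedFrom 1 e

-- ChainFrom k e ℓ : there are indices j₁ < ⋯ < j_ℓ of e with e_{j_i} ≥ k + i - 1
data ChainFrom : ℕ → List ℕ → ℕ → Set where
  done : ∀ {k e} → ChainFrom k e 0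
  skip : ∀ {k x es ℓ} → ChainFrom k es ℓ → ChainFrom k (x ∷ es) ℓ
  pick : ∀ {k x es ℓ} → k ≤ x → ChainFrom (suc k) es ℓ → ChainFrom k (x ∷ es) (suc ℓ)

HasChain : List ℕ → ℕ → Set
HasChain e ℓ = ChainFrom 1 e ℓ

IsSt : List ℕ → ℕ → Set
IsSt e ℓ = HasChain e ℓ × (∀ ℓ' → HasChain e ℓ' → ℓ' ≤ ℓ)

IsPerm : ℕ → List ℕ → Set
IsPerm n σ = σ ↭ ascFrom1 n

-- Han's step Ψ(σ, s) raises the number of excedances by one if s > exc σ and keeps it
-- otherwise. Letters left of the insertion position v keep their excedance status, since only
-- excedance tops are replaced, by larger letters. Letters right of v move one place right; one of
-- them could only lose its excedance if it equalled its new position, but such a letter is an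
-- excedance top ≥ v and is itself replaced by a larger one. The inserted letter aₘ exceeds v iff
-- v is not an excedance top, i.e. iff s > exc σ, because ν numbers the excedance tops first.
-- So along a HAN-code the excedance count c is advanced exactly when e_j ≥ c + 1, which is the
-- greedy computation of st; greedy is optimal because raising the threshold by one shortens the
-- greedy chain by at most one.

module Submission where

open import Defs
open import Data.Bool using (Bool; true; false; if_then_else_; not; T)
open import Data.Bool.Properties using (T-not-≡)
open import Data.Empty using (⊥-elim)
open import Data.List using (List; []; _∷_; _++_; length; map; filter; foldl; take; drop; upTo)
open import Data.List.Properties
  using (++-identityʳ; length-map; length-upTo; length-take; take-map; drop-map; take++drop≡id)
open import Data.List.Membership.Propositional using (_∈_; _∉_)
open import Data.List.Membership.Propositional.Properties
  using (∈-filter⁻; ∈-filter⁺; ∈-map⁻; ∈-map⁺; ∈-upTo⁺; ∈-upTo⁻; ∈-downFrom⁺; ∈-downFrom⁻)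
open import Data.List.Membership.Propositional.Properties.WithK using (unique∧set⇒bag)
open import Data.List.Relation.Binary.BagAndSetEquality using (∼bag⇒↭)
open import Data.List.Relation.Binary.Permutation.Propositional
  using (_↭_; ↭-sym; ↭-trans; ↭-prep; ↭-reflexive; ↭⇒↭ₛ)
open import Data.List.Relation.Binary.Permutation.Propositional.Properties using (↭-length; shift; ∈-resp-↭)
open import Data.List.Relation.Binary.Permutation.Setoid.Properties using (Unique-resp-↭)
open import Data.List.Relation.Unary.Any using (here; there)
open import Data.List.Relation.Unary.All as All using (All; []; _∷_)
open import Data.List.Relation.Unary.All.Properties using () renaming (map⁺ to All-map⁺)
open import Data.List.Relation.Unary.AllPairs using (AllPairs; []; _∷_)
import Data.List.Relation.Unary.AllPairs.Properties as AllPairs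
open import Data.List.Relation.Unary.Unique.Propositional using (Unique)
import Data.List.Relation.Unary.Unique.Propositional.Properties as Unique
open import Data.Nat using (ℕ; zero; suc; _+_; _∸_; _≤_; _<_; _>_; _<ᵇ_; _≤ᵇ_; _≡ᵇ_; z≤n; s≤s)
open import Data.Nat.Properties
open import Data.Nat.Solver using (module +-*-Solver)
open import Data.List.Membership.DecPropositional _≟_ using (_∈?_)
open import Data.Product as Product using (_×_; _,_; proj₁; proj₂)
open import Data.Sum using (_⊎_; inj₁; inj₂)
open import Data.Unit using (⊤; tt)
open import Function.Base using (_∘_)
open import Function.Bundles using (_⇔_; mk⇔; Equivalence)
open import Function.Construct.Identity using (⇔-id)
open import Relation.Nullary using (ofʸ; ofⁿ; yes; no)
open import Relation.Nullary.Decidable using (T?)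
open import Relation.Binary.PropositionalEquality

greedySt : ℕ → List ℕ → ℕ
greedySt k [] = 0
greedySt k (x ∷ xs) = if k ≤ᵇ x then suc (greedySt (suc k) xs) else greedySt k xs

chainFrom-greedySt : ∀ k xs → ChainFrom k xs (greedySt k xs)
chainFrom-greedySt k [] = done
chainFrom-greedySt k (x ∷ xs) with k ≤ᵇ x | ≤ᵇ-reflects-≤ k x
... | true  | ofʸ k≤x = pick k≤x (chainFrom-greedySt (suc k) xs)
... | false | _       = skip (chainFrom-greedySt k xs)

greedySt-≤-suc : ∀ k xs → greedySt k xs ≤ suc (greedySt (suc k) xs)
greedySt-≤-suc k [] = z≤n
greedySt-≤-suc k (x ∷ xs)
  with k ≤ᵇ x | ≤ᵇ-reflects-≤ k x | suc k ≤ᵇ x | ≤ᵇ-reflects-≤ (suc k) x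
... | true  | _       | true  | _        = s≤s (greedySt-≤-suc (suc k) xs)
... | true  | _       | false | _        = ≤-refl
... | false | ofⁿ k≰x | true  | ofʸ k<x  = ⊥-elim (k≰x (<⇒≤ k<x))
... | false | _       | false | _        = greedySt-≤-suc k xs

chainFrom⇒≤greedySt : ∀ {k xs ℓ} → ChainFrom k xs ℓ → ℓ ≤ greedySt k xs
chainFrom⇒≤greedySt done = z≤n
chainFrom⇒≤greedySt {k} {x ∷ xs} (skip c) with k ≤ᵇ x
... | true  = ≤-trans (chainFrom⇒≤greedySt c) (greedySt-≤-suc k xs)
... | false = chainFrom⇒≤greedySt c
chainFrom⇒≤greedySt {k} {x ∷ xs} (pick k≤x c) with k ≤ᵇ x | ≤ᵇ-reflects-≤ k x
... | true  | _       = s≤s (chainFrom⇒≤greedySt c)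
... | false | ofⁿ k≰x = ⊥-elim (k≰x k≤x)

isSt-greedySt : ∀ e → IsSt e (greedySt 1 e)
isSt-greedySt e = chainFrom-greedySt 1 e , λ _ → chainFrom⇒≤greedySt

<ᵇ-cong : ∀ {m n m′ n′} → (m < n ⇔ m′ < n′) → (m <ᵇ n) ≡ (m′ <ᵇ n′)
<ᵇ-cong {m} {n} {m′} {n′} m<n⇔m′<n′
  with m <ᵇ n | <ᵇ-reflects-< m n | m′ <ᵇ n′ | <ᵇ-reflects-< m′ n′
... | true  | _       | true  | _        = refl
... | false | _       | false | _        = refl
... | true  | ofʸ m<n | false | ofⁿ m′≮n′ = ⊥-elim (m′≮n′ (Equivalence.to m<n⇔m′<n′ m<n))
... | false | ofⁿ m≮n | true  | ofʸ m′<n′ = ⊥-elim (m≮n (Equivalence.from m<n⇔m′<n′ m′<n′))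

<ᵇ-irrefl : ∀ n → (n <ᵇ n) ≡ false
<ᵇ-irrefl zero    = refl
<ᵇ-irrefl (suc n) = <ᵇ-irrefl n

memb⇔∈ : ∀ {x} L → T (memb x L) ⇔ x ∈ L
memb⇔∈ L = mk⇔ (memb⇒∈ L) ∈⇒memb
  where
  memb⇒∈ : ∀ {x} L → T (memb x L) → x ∈ L
  memb⇒∈ {x} (y ∷ L) t with x ≡ᵇ y in x≡ᵇy
  ... | true  = here (≡ᵇ⇒≡ x y (subst T (sym x≡ᵇy) tt))
  ... | false = there (memb⇒∈ L t)
  ∈⇒memb : ∀ {x L} → x ∈ L → T (memb x L)
  ∈⇒memb {x} {y ∷ L} x∈ with x ≡ᵇ y in x≡ᵇy | x∈
  ... | true  | _          = tt
  ... | false | here refl  = ⊥-elim (subst T x≡ᵇy (≡⇒≡ᵇ x x refl))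
  ... | false | there x∈L = ∈⇒memb x∈L

≡ᵇ-refl : ∀ x → (x ≡ᵇ x) ≡ true
≡ᵇ-refl zero    = refl
≡ᵇ-refl (suc x) = ≡ᵇ-refl x

rotate : ℕ → List ℕ → ℕ → ℕ
rotate b L x = assoc x L (b ∷ L)

rotate-head : ∀ b a L → rotate b (a ∷ L) a ≡ b
rotate-head b a L rewrite ≡ᵇ-refl a = refl

rotate-tail : ∀ {x} b a L → x ≢ a → rotate b (a ∷ L) x ≡ rotate a L x
rotate-tail {x} b a L x≢a with x ≡ᵇ a in x≡ᵇa
... | true  = ⊥-elim (x≢a (≡ᵇ⇒≡ x a (subst T (sym x≡ᵇa) tt)))
... | false = refl

rotate-∉ : ∀ {x} b L → x ∉ L → rotate b L x ≡ x
rotate-∉ b []      x∉L = refl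
rotate-∉ b (a ∷ L) x∉L =
  trans (rotate-tail b a L (λ x≡a → x∉L (here x≡a))) (rotate-∉ a L (λ x∈L → x∉L (there x∈L)))

rotate-∈ : ∀ {x b L} → AllPairs _>_ L → All (_< b) L → x ∈ L →
           x < rotate b L x × (rotate b L x ≡ b ⊎ rotate b L x ∈ L)
rotate-∈ {b = b} {a ∷ L} _ (a<b ∷ _) (here refl) rewrite rotate-head b a L = a<b , inj₁ refl
rotate-∈ {b = b} {a ∷ L} (a>L ∷ L↓) _ (there x∈L)
  rewrite rotate-tail b a L (<⇒≢ (All.lookup a>L x∈L))
  with rotate-∈ L↓ a>L x∈L
... | x<r , inj₁ r≡a = x<r , inj₂ (here r≡a)
... | x<r , inj₂ r∈L = x<r , inj₂ (there r∈L)

rotate-≤ : ∀ {x b L} → AllPairs _>_ L → All (_< b) L → x ∈ L → rotate b L x ≤ b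
rotate-≤ L↓ L<b x∈L with rotate-∈ L↓ L<b x∈L
... | _ , inj₁ r≡b = ≤-reflexive r≡b
... | _ , inj₂ r∈L = <⇒≤ (All.lookup L<b r∈L)

rotate-head≢ : ∀ {y b a L} → AllPairs _>_ (a ∷ L) → All (_< b) (a ∷ L) → y ∈ L →
               rotate b (a ∷ L) a ≢ rotate b (a ∷ L) y
rotate-head≢ {y} {b} {a} {L} (a>L ∷ L↓) (a<b ∷ _) y∈L r≡r =
  <⇒≢ (≤-<-trans (rotate-≤ L↓ a>L y∈L) a<b) (begin
    rotate a L y          ≡⟨ rotate-tail b a L (<⇒≢ (All.lookup a>L y∈L)) ⟨
    rotate b (a ∷ L) y    ≡⟨ r≡r ⟨
    rotate b (a ∷ L) a    ≡⟨ rotate-head b a L ⟩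
    b                     ∎)
  where open ≡-Reasoning

rotate-injective : ∀ {x y b L} → AllPairs _>_ L → All (_< b) L → x ∈ L → y ∈ L →
                   rotate b L x ≡ rotate b L y → x ≡ y
rotate-injective _ _ (here refl) (here refl) _ = refl
rotate-injective L↓ L<b (here refl) (there y∈L) r≡r = ⊥-elim (rotate-head≢ L↓ L<b y∈L r≡r)
rotate-injective L↓ L<b (there x∈L) (here refl) r≡r = ⊥-elim (rotate-head≢ L↓ L<b x∈L (sym r≡r))
rotate-injective {x} {y} {b} {a ∷ L} (a>L ∷ L↓) _ (there x∈L) (there y∈L) r≡r =
  rotate-injective L↓ a>L x∈L y∈L (begin
    rotate a L x          ≡⟨ rotate-tail b a L (<⇒≢ (All.lookup a>L x∈L)) ⟨
    rotate b (a ∷ L) x    ≡⟨ r≡r ⟩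
    rotate b (a ∷ L) y    ≡⟨ rotate-tail b a L (<⇒≢ (All.lookup a>L y∈L)) ⟩
    rotate a L y          ∎)
  where open ≡-Reasoning

last-∈ : ∀ d L → (L ≡ [] × last d L ≡ d) ⊎ last d L ∈ L
last-∈ d []      = inj₁ (refl , refl)
last-∈ d (x ∷ L) with last-∈ x L
... | inj₁ (_ , last≡x) = inj₂ (here last≡x)
... | inj₂ last∈L       = inj₂ (there last∈L)

last-≤ : ∀ d L {y} → AllPairs _>_ L → y ∈ L → last d L ≤ y
last-≤ d (x ∷ L) (x>L ∷ _) (here refl) with last-∈ x L
... | inj₁ (_ , last≡x) = ≤-reflexive last≡x
... | inj₂ last∈L       = <⇒≤ (All.lookup x>L last∈L)
last-≤ d (x ∷ L) (_ ∷ L↓) (there y∈L) = last-≤ x L L↓ y∈L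

nth-∈ : ∀ i L → i < length L → nth (suc i) L ∈ L
nth-∈ zero    (x ∷ L) _         = here refl
nth-∈ (suc i) (x ∷ L) (s≤s i<) = there (nth-∈ i L i<)

nth-++ : ∀ i A B → i < length A + length B →
         (i < length A × nth (suc i) (A ++ B) ∈ A) ⊎ (length A ≤ i × nth (suc i) (A ++ B) ∈ B)
nth-++ i       []      B i<      = inj₂ (z≤n , nth-∈ i B i<)
nth-++ zero    (x ∷ A) B _       = inj₁ (s≤s z≤n , here refl)
nth-++ (suc i) (x ∷ A) B (s≤s i<) with nth-++ i A B i<
... | inj₁ (i<A , y∈A) = inj₁ (s≤s i<A , there y∈A)
... | inj₂ (A≤i , y∈B) = inj₂ (s≤s A≤i , y∈B)

length-filter-memb : ∀ {L D} → Unique L → Unique D → (∀ {y} → y ∈ L → y ∈ D) →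
                     length (filter (λ x → T? (memb x L)) D) ≡ length L
length-filter-memb {L} {D} L! D! L⊆D =
  ↭-length (∼bag⇒↭ (unique∧set⇒bag (Unique.filter⁺ (λ x → T? (memb x L)) {D} D!) L! same-members))
  where
  same-members : ∀ {y} → y ∈ filter (λ x → T? (memb x L)) D ⇔ y ∈ L
  same-members = mk⇔
    (λ y∈ → Equivalence.to (memb⇔∈ L) (proj₂ (∈-filter⁻ (λ x → T? (memb x L)) {xs = D} y∈)))
    (λ y∈L → ∈-filter⁺ (λ x → T? (memb x L)) (L⊆D y∈L) (Equivalence.from (memb⇔∈ L) y∈L))

length-filter-+-not : ∀ (b : ℕ → Bool) xs →
  length (filter (λ x → T? (b x)) xs) + length (filter (λ x → T? (not (b x))) xs) ≡ length xs
length-filter-+-not b [] = refl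
length-filter-+-not b (x ∷ xs) with b x
... | true  = cong suc (length-filter-+-not b xs)
... | false = trans (+-suc _ _) (cong suc (length-filter-+-not b xs))

∈-descTo1⁻ : ∀ {y} m → y ∈ descTo1 m → 1 ≤ y × y ≤ m
∈-descTo1⁻ m y∈ with ∈-map⁻ suc y∈
... | _ , z∈ , refl = s≤s z≤n , ∈-downFrom⁻ z∈

∈-descTo1⁺ : ∀ {y} m → 1 ≤ y → y ≤ m → y ∈ descTo1 m
∈-descTo1⁺ {suc y} m _ y≤m = ∈-map⁺ suc (∈-downFrom⁺ y≤m)

∈-ascFrom1⁻ : ∀ {y} m → y ∈ ascFrom1 m → 1 ≤ y × y ≤ m
∈-ascFrom1⁻ m y∈ with ∈-map⁻ suc y∈
... | _ , z∈ , refl = s≤s z≤n , ∈-upTo⁻ z∈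

∈-ascFrom1⁺ : ∀ {y} m → 1 ≤ y → y ≤ m → y ∈ ascFrom1 m
∈-ascFrom1⁺ {suc y} m _ y≤m = ∈-map⁺ suc (∈-upTo⁺ y≤m)

descTo1-unique : ∀ m → Unique (descTo1 m)
descTo1-unique m = Unique.map⁺ suc-injective (Unique.downFrom⁺ m)

ascFrom1-unique : ∀ m → Unique (ascFrom1 m)
ascFrom1-unique m = Unique.map⁺ suc-injective (Unique.upTo⁺ m)

descTo1-decreasing : ∀ m → AllPairs _>_ (descTo1 m)
descTo1-decreasing zero    = []
descTo1-decreasing (suc m) = All.tabulate (λ y∈ → s≤s (proj₂ (∈-descTo1⁻ m y∈))) ∷ descTo1-decreasing m

length-ascFrom1 : ∀ m → length (ascFrom1 m) ≡ m
length-ascFrom1 m = trans (length-map suc (upTo m)) (length-upTo m)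

excFrom-++ : ∀ j xs ys → excFrom j (xs ++ ys) ≡ excFrom j xs + excFrom (j + length xs) ys
excFrom-++ j [] ys rewrite +-identityʳ j = refl
excFrom-++ j (x ∷ xs) ys rewrite excFrom-++ (suc j) xs ys | +-suc j (length xs) =
  sym (+-assoc (if j <ᵇ x then 1 else 0) (excFrom (suc j) xs) _)

length-excTopsFrom : ∀ j xs → length (excTopsFrom j xs) ≡ excFrom j xs
length-excTopsFrom j [] = refl
length-excTopsFrom j (x ∷ xs) with j <ᵇ x
... | true  = cong suc (length-excTopsFrom (suc j) xs)
... | false = length-excTopsFrom (suc j) xs

∈-excTopsFrom⁻ : ∀ {y} j xs → y ∈ excTopsFrom j xs → y ∈ xs × j < y
∈-excTopsFrom⁻ j (x ∷ xs) y∈ with j <ᵇ x | <ᵇ-reflects-< j x | y∈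
... | true  | ofʸ j<x | here refl = here refl , j<x
... | true  | _       | there y∈′ = Product.map there <⇒≤ (∈-excTopsFrom⁻ (suc j) xs y∈′)
... | false | _       | y∈′       = Product.map there <⇒≤ (∈-excTopsFrom⁻ (suc j) xs y∈′)

excTopsFrom-unique : ∀ j {xs} → Unique xs → Unique (excTopsFrom j xs)
excTopsFrom-unique j []             = []
excTopsFrom-unique j {x ∷ xs} (x≢xs ∷ xs!) with j <ᵇ x
... | true  = All.tabulate (λ y∈ → All.lookup x≢xs (proj₁ (∈-excTopsFrom⁻ (suc j) xs y∈)))
              ∷ excTopsFrom-unique (suc j) xs!
... | false = excTopsFrom-unique (suc j) xs!

AllAt : (ℕ → ℕ → Set) → ℕ → List ℕ → Set
AllAt Q j []       = ⊤
AllAt Q j (x ∷ xs) = Q j x × AllAt Q (suc j) xs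

AllAt-map : ∀ {Q Q′ : ℕ → ℕ → Set} j xs → (∀ {p x} → x ∈ xs → Q p x → Q′ p x) →
            AllAt Q j xs → AllAt Q′ j xs
AllAt-map j []       _ _          = tt
AllAt-map j (x ∷ xs) f (qx , qxs) = f (here refl) qx , AllAt-map (suc j) xs (λ x∈ → f (there x∈)) qxs

AllAt-take : ∀ {Q : ℕ → ℕ → Set} j k xs → AllAt Q j xs → AllAt Q j (take k xs)
AllAt-take j zero    xs       _          = tt
AllAt-take j (suc k) []       _          = tt
AllAt-take j (suc k) (x ∷ xs) (qx , qxs) = qx , AllAt-take (suc j) k xs qxs

AllAt-drop : ∀ {Q : ℕ → ℕ → Set} j k xs → AllAt Q j xs → AllAt Q (j + k) (drop k xs)
AllAt-drop {Q} j zero    xs       q          = subst (λ i → AllAt Q i xs) (sym (+-identityʳ j)) q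
AllAt-drop     j (suc k) []       _          = tt
AllAt-drop {Q} j (suc k) (x ∷ xs) (_ , qxs)  =
  subst (λ i → AllAt Q i (drop k xs)) (sym (+-suc j k)) (AllAt-drop (suc j) k xs qxs)

excTopsFrom-⇔ : ∀ j {xs} → Unique xs → AllAt (λ p x → x ∈ excTopsFrom j xs ⇔ p < x) j xs
excTopsFrom-⇔ j {[]}     _ = tt
excTopsFrom-⇔ j {x ∷ xs} (x≢xs ∷ xs!) with j <ᵇ x | <ᵇ-reflects-< j x
... | true  | ofʸ j<x =
  mk⇔ (λ _ → j<x) (λ _ → here refl) ,
  AllAt-map (suc j) xs (λ y∈ y∈T⇔ → ∈-∷-⇔ (All.lookup x≢xs y∈ ∘ sym) y∈T⇔)
    (excTopsFrom-⇔ (suc j) xs!)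
  where
  ∈-∷-⇔ : ∀ {y T P} → y ≢ x → (y ∈ T ⇔ P) → (y ∈ x ∷ T ⇔ P)
  ∈-∷-⇔ y≢x y∈T⇔ = mk⇔
    (λ { (here y≡x) → ⊥-elim (y≢x y≡x) ; (there y∈T) → Equivalence.to y∈T⇔ y∈T })
    (λ p → there (Equivalence.from y∈T⇔ p))
... | false | ofⁿ j≮x =
  mk⇔ (λ x∈T → ⊥-elim (All.lookup x≢xs (proj₁ (∈-excTopsFrom⁻ (suc j) xs x∈T)) refl))
      (λ j<x → ⊥-elim (j≮x j<x)) ,
  excTopsFrom-⇔ (suc j) xs!

excFrom-map : ∀ d (f : ℕ → ℕ) {Q : ℕ → ℕ → Set} j xs →
              (∀ {p x} → j ≤ p → Q p x → (d + p < f x ⇔ p < x)) →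
              AllAt Q j xs → excFrom (d + j) (map f xs) ≡ excFrom j xs
excFrom-map d f j []       _ _          = refl
excFrom-map d f j (x ∷ xs) h (qx , qxs) = cong₂ _+_
  (cong (λ b → if b then 1 else 0) (<ᵇ-cong (h ≤-refl qx)))
  (trans (cong (λ i → excFrom i (map f xs)) (sym (+-suc d j)))
         (excFrom-map d f (suc j) xs (λ j<p → h (<⇒≤ j<p)) qxs))

Unique-map⁺ : ∀ {f : ℕ → ℕ} {xs} → (∀ {x y} → x ∈ xs → y ∈ xs → f x ≡ f y → x ≡ y) →
              Unique xs → Unique (map f xs)
Unique-map⁺ {xs = []}     _   []          = []
Unique-map⁺ {xs = x ∷ xs} inj (x≢xs ∷ xs!) =
  All-map⁺ (All.tabulate (λ y∈ fx≡fy → All.lookup x≢xs y∈ (inj (here refl) (there y∈) fx≡fy)))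
  ∷ Unique-map⁺ (λ x∈ y∈ → inj (there x∈) (there y∈)) xs!

length-take-≤ : ∀ k (xs : List ℕ) → k ≤ length xs → length (take k xs) ≡ k
length-take-≤ k xs k≤ = trans (length-take k xs) (m≤n⇒m⊓n≡m k≤)

excFrom-take-drop : ∀ j k xs → k ≤ length xs →
                    excFrom j xs ≡ excFrom j (take k xs) + excFrom (j + k) (drop k xs)
excFrom-take-drop j k xs k≤ = begin
  excFrom j xs                                                      ≡⟨ cong (excFrom j) (take++drop≡id k xs) ⟨
  excFrom j (take k xs ++ drop k xs)                                ≡⟨ excFrom-++ j (take k xs) (drop k xs) ⟩
  excFrom j (take k xs) + excFrom (j + length (take k xs)) (drop k xs)
    ≡⟨ cong (λ i → excFrom j (take k xs) + excFrom (j + i) (drop k xs)) (length-take-≤ k xs k≤) ⟩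
  excFrom j (take k xs) + excFrom (j + k) (drop k xs)               ∎
  where open ≡-Reasoning

record InjectiveWord (m : ℕ) (σ : List ℕ) : Set where
  field
    length≡ : length σ ≡ m
    unique  : Unique σ
    bounded : ∀ {x} → x ∈ σ → x ≤ m

InjectiveWord-resp-↭ : ∀ {m xs ys} → xs ↭ ys → InjectiveWord m ys → InjectiveWord m xs
InjectiveWord-resp-↭ xs↭ys w = record
  { length≡ = trans (↭-length xs↭ys) length≡
  ; unique  = Unique-resp-↭ (setoid ℕ) (↭⇒↭ₛ (↭-sym xs↭ys)) unique
  ; bounded = λ x∈xs → bounded (∈-resp-↭ xs↭ys x∈xs)
  }
  where open InjectiveWord w

∷-injectiveWord : ∀ {m σ} → InjectiveWord m σ → InjectiveWord (suc m) (suc m ∷ σ)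
∷-injectiveWord w = record
  { length≡ = cong suc length≡
  ; unique  = All.tabulate (λ x∈σ 1+m≡x → <-irrefl (sym 1+m≡x) (s≤s (bounded x∈σ))) ∷ unique
  ; bounded = λ { (here refl) → ≤-refl ; (there x∈σ) → m≤n⇒m≤1+n (bounded x∈σ) }
  }
  where open InjectiveWord w

module ΨInsertion (σ : List ℕ) (s : ℕ) (σ! : Unique σ) (σ≤ : ∀ {x} → x ∈ σ → x ≤ length σ)
                  (s<m : s < length σ) where

  -- These mirror the local definitions of Ψ, so that Ψ σ (suc s) unfolds to
  -- take k σ′ ++ aₘ ∷ drop k σ′.
  m n : ℕ
  m = length σ
  n = suc m

  tops : List ℕ
  tops = excTops σ

  isTop : ℕ → Bool
  isTop x = memb x tops

  A B : List ℕ
  A = filter (λ x → T? (isTop x)) (descTo1 m)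
  B = filter (λ x → T? (not (isTop x))) (ascFrom1 m)

  v : ℕ
  v = nth (suc s) (A ++ B)

  as : List ℕ
  as = filter (λ x → T? (v ≤ᵇ x)) A

  aₘ : ℕ
  aₘ = last n as

  f : ℕ → ℕ
  f = rotate n as

  σ′ : List ℕ
  σ′ = map f σ

  k : ℕ
  k = v ∸ 1

  isTop⇔ : ∀ {y} → T (isTop y) ⇔ y ∈ tops
  isTop⇔ = memb⇔∈ tops

  top⇔ : AllAt (λ p x → x ∈ tops ⇔ p < x) 1 σ
  top⇔ = excTopsFrom-⇔ 1 σ!

  top-bounds : ∀ {y} → y ∈ tops → 1 ≤ y × y ≤ m
  top-bounds y∈ with ∈-excTopsFrom⁻ 1 σ y∈
  ... | y∈σ , 1<y = <⇒≤ 1<y , σ≤ y∈σ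

  length-filter-isTop : ∀ D → Unique D → (∀ {y} → 1 ≤ y → y ≤ m → y ∈ D) →
                        length (filter (λ x → T? (isTop x)) D) ≡ exc σ
  length-filter-isTop D D! ⊇[1,m] =
    trans (length-filter-memb (excTopsFrom-unique 1 σ!) D! (λ y∈ → Product.uncurry ⊇[1,m] (top-bounds y∈)))
          (length-excTopsFrom 1 σ)

  length-A : length A ≡ exc σ
  length-A = length-filter-isTop (descTo1 m) (descTo1-unique m) (∈-descTo1⁺ m)

  length-A+B : length A + length B ≡ m
  length-A+B = begin
    length A + length B
      ≡⟨ cong (_+ length B) (trans length-A (sym tops-in-ascFrom1)) ⟩
    length (filter (λ x → T? (isTop x)) (ascFrom1 m)) + length B ≡⟨ length-filter-+-not isTop (ascFrom1 m) ⟩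
    length (ascFrom1 m)                                           ≡⟨ length-ascFrom1 m ⟩
    m                                                             ∎
    where
    open ≡-Reasoning
    tops-in-ascFrom1 : length (filter (λ x → T? (isTop x)) (ascFrom1 m)) ≡ exc σ
    tops-in-ascFrom1 = length-filter-isTop (ascFrom1 m) (ascFrom1-unique m) (∈-ascFrom1⁺ m)

  ∈A⁻ : ∀ {y} → y ∈ A → y ∈ tops × 1 ≤ y × y ≤ m
  ∈A⁻ y∈ with ∈-filter⁻ (λ x → T? (isTop x)) {xs = descTo1 m} y∈
  ... | y∈D , top = Equivalence.to isTop⇔ top , ∈-descTo1⁻ m y∈D

  ∈B⁻ : ∀ {y} → y ∈ B → y ∉ tops × 1 ≤ y × y ≤ m
  ∈B⁻ y∈ with ∈-filter⁻ (λ x → T? (not (isTop x))) {xs = ascFrom1 m} y∈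
  ... | y∈D , ¬top = (λ y∈tops → subst T (Equivalence.to T-not-≡ ¬top) (Equivalence.from isTop⇔ y∈tops))
                   , ∈-ascFrom1⁻ m y∈D

  v∈A⊎B : (v ∈ A × s < exc σ) ⊎ (v ∈ B × exc σ ≤ s)
  v∈A⊎B with nth-++ s A B (subst (s <_) (sym length-A+B) s<m)
  ... | inj₁ (s<A , v∈A) = inj₁ (v∈A , subst (s <_) length-A s<A)
  ... | inj₂ (A≤s , v∈B) = inj₂ (v∈B , subst (_≤ s) length-A A≤s)

  v-bounds : 1 ≤ v × v ≤ m
  v-bounds with v∈A⊎B
  ... | inj₁ (v∈A , _) = proj₂ (∈A⁻ v∈A)
  ... | inj₂ (v∈B , _) = proj₂ (∈B⁻ v∈B)

  ∈as⁻ : ∀ {y} → y ∈ as → v ≤ y × y ∈ tops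
  ∈as⁻ y∈ with ∈-filter⁻ (λ x → T? (v ≤ᵇ x)) {xs = A} y∈
  ... | y∈A , v≤y = ≤ᵇ⇒≤ v _ v≤y , proj₁ (∈A⁻ y∈A)

  ∈as⁺ : ∀ {y} → v ≤ y → y ∈ tops → y ∈ as
  ∈as⁺ v≤y y∈tops = ∈-filter⁺ (λ x → T? (v ≤ᵇ x))
    (∈-filter⁺ (λ x → T? (isTop x)) (Product.uncurry (∈-descTo1⁺ m) (top-bounds y∈tops))
                                     (Equivalence.from isTop⇔ y∈tops))
    (≤⇒≤ᵇ v≤y)

  as-decreasing : AllPairs _>_ as
  as-decreasing = AllPairs.filter⁺ (λ x → T? (v ≤ᵇ x))
                    (AllPairs.filter⁺ (λ x → T? (isTop x)) (descTo1-decreasing m))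

  as<n : All (_< n) as
  as<n = All.tabulate (λ y∈ → s≤s (proj₂ (top-bounds (proj₂ (∈as⁻ y∈)))))

  f-∉ : ∀ {y} → y ∉ as → f y ≡ y
  f-∉ = rotate-∉ n as

  f-∈ : ∀ {y} → y ∈ as → y < f y × (f y ≡ n ⊎ f y ∈ as)
  f-∈ = rotate-∈ as-decreasing as<n

  aₘ-∈ : (as ≡ [] × aₘ ≡ n) ⊎ aₘ ∈ as
  aₘ-∈ = last-∈ n as

  top⇒aₘ≤v : v ∈ tops → aₘ ≤ v
  top⇒aₘ≤v v∈tops = last-≤ n as as-decreasing (∈as⁺ ≤-refl v∈tops)

  ¬top⇒v<aₘ : v ∉ tops → v < aₘ
  ¬top⇒v<aₘ v∉tops with aₘ-∈
  ... | inj₁ (_ , aₘ≡n) = subst (v <_) (sym aₘ≡n) (s≤s (proj₂ v-bounds))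
  ... | inj₂ aₘ∈as with ∈as⁻ aₘ∈as
  ...   | v≤aₘ , aₘ∈tops = ≤∧≢⇒< v≤aₘ (λ v≡aₘ → v∉tops (subst (_∈ tops) (sym v≡aₘ) aₘ∈tops))

  v<aₘ⇔ : v < aₘ ⇔ exc σ < suc s
  v<aₘ⇔ with v∈A⊎B
  ... | inj₁ (v∈A , s<exc) = mk⇔ (λ v<aₘ → ⊥-elim (<⇒≱ v<aₘ (top⇒aₘ≤v (proj₁ (∈A⁻ v∈A)))))
                                 (λ exc≤s → ⊥-elim (<⇒≱ s<exc (≤-pred exc≤s)))
  ... | inj₂ (v∈B , exc≤s) = mk⇔ (λ _ → s≤s exc≤s) (λ _ → ¬top⇒v<aₘ (proj₁ (∈B⁻ v∈B)))

  f-keeps-excedance : ∀ {p x} → (x ∈ tops ⇔ p < x) → (p < f x ⇔ p < x)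
  f-keeps-excedance {p} {x} top⇔p<x with x ∈? as
  ... | yes x∈as = mk⇔ (λ _ → p<x) (λ _ → <-trans p<x (proj₁ (f-∈ x∈as)))
    where p<x = Equivalence.to top⇔p<x (proj₂ (∈as⁻ x∈as))
  ... | no  x∉as = subst (λ y → p < y ⇔ p < x) (sym (f-∉ x∉as)) (⇔-id _)

  f-shifts-excedance : ∀ {p x} → v ≤ p → (x ∈ tops ⇔ p < x) → (suc p < f x ⇔ p < x)
  f-shifts-excedance {p} {x} v≤p top⇔p<x with x ∈? as
  ... | yes x∈as = mk⇔ (λ _ → p<x) (λ _ → ≤-<-trans p<x (proj₁ (f-∈ x∈as)))
    where p<x = Equivalence.to top⇔p<x (proj₂ (∈as⁻ x∈as))
  ... | no  x∉as = subst (λ y → suc p < y ⇔ p < x) (sym (f-∉ x∉as)) (mk⇔ (<-trans (n<1+n p)) p<x⇒1+p<x)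
    where
    p<x⇒1+p<x : p < x → suc p < x
    p<x⇒1+p<x p<x = ≤∧≢⇒< p<x λ 1+p≡x →
      x∉as (∈as⁺ (≤-trans v≤p (≤-trans (n≤1+n p) (≤-reflexive 1+p≡x))) (Equivalence.from top⇔p<x p<x))

  1+k≡v : suc k ≡ v
  1+k≡v = trans (+-comm 1 k) (m∸n+n≡m (proj₁ v-bounds))

  k≤m : k ≤ m
  k≤m = ≤-trans (m∸n≤m v 1) (proj₂ v-bounds)

  exc-Ψ : exc (Ψ σ (suc s)) ≡ exc σ + (if exc σ <ᵇ suc s then 1 else 0)
  exc-Ψ = begin
    excFrom 1 (take k σ′ ++ aₘ ∷ drop k σ′)
      ≡⟨ excFrom-++ 1 (take k σ′) (aₘ ∷ drop k σ′) ⟩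
    excFrom 1 (take k σ′) + excFrom (suc (length (take k σ′))) (aₘ ∷ drop k σ′)
      ≡⟨ cong (λ i → excFrom 1 (take k σ′) + excFrom (suc i) (aₘ ∷ drop k σ′))
              (length-take-≤ k σ′ k≤|σ′|) ⟩
    excFrom 1 (take k σ′) + (bit (suc k <ᵇ aₘ) + excFrom (2 + k) (drop k σ′))
      ≡⟨ cong₂ (λ T D → excFrom 1 T + (bit (suc k <ᵇ aₘ) + excFrom (2 + k) D))
               (take-map k σ) (drop-map k σ) ⟩
    excFrom 1 (map f (take k σ)) + (bit (suc k <ᵇ aₘ) + excFrom (2 + k) (map f (drop k σ)))
      ≡⟨ cong₂ _+_ excFrom-before-v (cong₂ _+_ (cong bit excedance-at-v) excFrom-after-v) ⟩
    excFrom 1 (take k σ) + (bit (exc σ <ᵇ suc s) + excFrom (suc k) (drop k σ))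
      ≡⟨ solve 3 (λ t c d → t :+ (c :+ d) := (t :+ d) :+ c) refl (excFrom 1 (take k σ)) _ _ ⟩
    excFrom 1 (take k σ) + excFrom (suc k) (drop k σ) + bit (exc σ <ᵇ suc s)
      ≡⟨ cong (_+ bit (exc σ <ᵇ suc s)) (excFrom-take-drop 1 k σ k≤m) ⟨
    exc σ + bit (exc σ <ᵇ suc s) ∎
    where
    open ≡-Reasoning
    open +-*-Solver
    bit : Bool → ℕ
    bit b = if b then 1 else 0
    k≤|σ′| : k ≤ length σ′
    k≤|σ′| = subst (k ≤_) (sym (length-map f σ)) k≤m
    excFrom-before-v : excFrom 1 (map f (take k σ)) ≡ excFrom 1 (take k σ)
    excFrom-before-v = excFrom-map 0 f 1 (take k σ) (λ _ → f-keeps-excedance) (AllAt-take 1 k σ top⇔)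
    excFrom-after-v : excFrom (2 + k) (map f (drop k σ)) ≡ excFrom (suc k) (drop k σ)
    excFrom-after-v = excFrom-map 1 f (suc k) (drop k σ)
      (λ 1+k≤p → f-shifts-excedance (subst (_≤ _) 1+k≡v 1+k≤p)) (AllAt-drop 1 k σ top⇔)
    excedance-at-v : (suc k <ᵇ aₘ) ≡ (exc σ <ᵇ suc s)
    excedance-at-v = <ᵇ-cong (subst (λ i → i < aₘ ⇔ exc σ < suc s) (sym 1+k≡v) v<aₘ⇔)

  f-∈≢f-∉ : ∀ {x y} → x ∈ as → y ∈ σ → y ∉ as → f x ≢ f y
  f-∈≢f-∉ {x} {y} x∈as y∈σ y∉as fx≡fy with proj₂ (f-∈ x∈as)
  ... | inj₁ fx≡n  = <-irrefl (trans (sym (f-∉ y∉as)) (trans (sym fx≡fy) fx≡n)) (s≤s (σ≤ y∈σ))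
  ... | inj₂ fx∈as = y∉as (subst (_∈ as) (trans fx≡fy (f-∉ y∉as)) fx∈as)

  f-injective : ∀ {x y} → x ∈ σ → y ∈ σ → f x ≡ f y → x ≡ y
  f-injective {x} {y} x∈σ y∈σ fx≡fy with x ∈? as | y ∈? as
  ... | yes x∈as | yes y∈as = rotate-injective as-decreasing as<n x∈as y∈as fx≡fy
  ... | yes x∈as | no  y∉as = ⊥-elim (f-∈≢f-∉ x∈as y∈σ y∉as fx≡fy)
  ... | no  x∉as | yes y∈as = ⊥-elim (f-∈≢f-∉ y∈as x∈σ x∉as (sym fx≡fy))
  ... | no  x∉as | no  y∉as = trans (sym (f-∉ x∉as)) (trans fx≡fy (f-∉ y∉as))

  aₘ∉σ′ : aₘ ∉ σ′
  aₘ∉σ′ aₘ∈σ′ with ∈-map⁻ f aₘ∈σ′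
  ... | x , x∈σ , aₘ≡fx with x ∈? as
  ...   | yes x∈as =
    <⇒≱ (proj₁ (f-∈ x∈as)) (≤-trans (≤-reflexive (sym aₘ≡fx)) (last-≤ n as as-decreasing x∈as))
  ...   | no  x∉as with aₘ-∈
  ...     | inj₁ (_ , aₘ≡n) = <-irrefl (trans (sym (f-∉ x∉as)) (trans (sym aₘ≡fx) aₘ≡n)) (s≤s (σ≤ x∈σ))
  ...     | inj₂ aₘ∈as      = x∉as (subst (_∈ as) (trans aₘ≡fx (f-∉ x∉as)) aₘ∈as)

  aₘ≤n : aₘ ≤ n
  aₘ≤n with aₘ-∈
  ... | inj₁ (_ , aₘ≡n) = ≤-reflexive aₘ≡n
  ... | inj₂ aₘ∈as      = <⇒≤ (All.lookup as<n aₘ∈as)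

  σ′-bounded : ∀ {y} → y ∈ σ′ → y ≤ n
  σ′-bounded y∈σ′ with ∈-map⁻ f y∈σ′
  ... | x , x∈σ , refl with x ∈? as
  ...   | yes x∈as = rotate-≤ as-decreasing as<n x∈as
  ...   | no  x∉as = subst (_≤ n) (sym (f-∉ x∉as)) (m≤n⇒m≤1+n (σ≤ x∈σ))

  aₘ∷σ′-injectiveWord : InjectiveWord n (aₘ ∷ σ′)
  aₘ∷σ′-injectiveWord = record
    { length≡ = cong suc (length-map f σ)
    ; unique  = All.tabulate (λ y∈σ′ aₘ≡y → aₘ∉σ′ (subst (_∈ σ′) (sym aₘ≡y) y∈σ′))
                ∷ Unique-map⁺ f-injective σ!
    ; bounded = λ { (here refl) → aₘ≤n ; (there y∈σ′) → σ′-bounded y∈σ′ }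
    }

  Ψ↭aₘ∷σ′ : Ψ σ (suc s) ↭ aₘ ∷ σ′
  Ψ↭aₘ∷σ′ = ↭-trans (shift aₘ (take k σ′) (drop k σ′))
                     (↭-prep aₘ (↭-reflexive (take++drop≡id k σ′)))

Ψ-zero↭ : ∀ σ → Ψ σ 0 ↭ suc (length σ) ∷ σ
Ψ-zero↭ σ = ↭-trans (shift (suc (length σ)) σ []) (↭-prep _ (↭-reflexive (++-identityʳ σ)))

Ψ-injectiveWord : ∀ {m σ} s → InjectiveWord m σ → s ≤ m → InjectiveWord (suc m) (Ψ σ s)
Ψ-injectiveWord {σ = σ} zero w _ with refl ← InjectiveWord.length≡ w =
  InjectiveWord-resp-↭ (Ψ-zero↭ σ) (∷-injectiveWord w)
Ψ-injectiveWord {σ = σ} (suc s) (record { length≡ = refl ; unique = σ! ; bounded = σ≤ }) s<m =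
  InjectiveWord-resp-↭ Ψ↭aₘ∷σ′ aₘ∷σ′-injectiveWord
  where open ΨInsertion σ s σ! σ≤ s<m

exc-Ψ : ∀ {m σ} s → InjectiveWord m σ → s ≤ m → exc (Ψ σ s) ≡ exc σ + (if exc σ <ᵇ s then 1 else 0)
exc-Ψ {σ = σ} zero _ _ = begin
  excFrom 1 (σ ++ suc (length σ) ∷ [])              ≡⟨ excFrom-++ 1 σ (suc (length σ) ∷ []) ⟩
  exc σ + ((if suc (length σ) <ᵇ suc (length σ) then 1 else 0) + 0)
    ≡⟨ cong (λ b → exc σ + ((if b then 1 else 0) + 0)) (<ᵇ-irrefl (length σ)) ⟩
  exc σ + 0                                          ∎
  where open ≡-Reasoning
exc-Ψ {σ = σ} (suc s) (record { length≡ = refl ; unique = σ! ; bounded = σ≤ }) s<m =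
  ΨInsertion.exc-Ψ σ s σ! σ≤ s<m

greedySt-after-Ψ : ∀ c x xs → let c′ = c + (if c <ᵇ x then 1 else 0) in
                   c′ + greedySt (suc c′) xs ≡ c + greedySt (suc c) (x ∷ xs)
greedySt-after-Ψ c x xs with c <ᵇ x
... | true  = trans (cong (λ i → i + greedySt (suc i) xs) (+-comm c 1)) (sym (+-suc c _))
... | false = cong (λ i → i + greedySt (suc i) xs) (+-identityʳ c)

exc-foldl-Ψ : ∀ {m σ} xs → InjectiveWord m σ → BoundedFrom (suc m) xs →
              exc (foldl Ψ σ xs) ≡ exc σ + greedySt (suc (exc σ)) xs
exc-foldl-Ψ         []       _ _                 = sym (+-identityʳ _)
exc-foldl-Ψ {σ = σ} (x ∷ xs) w (s≤s x≤m , xs≤) = begin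
  exc (foldl Ψ (Ψ σ x) xs)                       ≡⟨ exc-foldl-Ψ xs (Ψ-injectiveWord x w x≤m) xs≤ ⟩
  exc (Ψ σ x) + greedySt (suc (exc (Ψ σ x))) xs  ≡⟨ cong (λ c → c + greedySt (suc c) xs) (exc-Ψ x w x≤m) ⟩
  _                                              ≡⟨ greedySt-after-Ψ (exc σ) x xs ⟩
  exc σ + greedySt (suc (exc σ)) (x ∷ xs)        ∎
  where open ≡-Reasoning

mainTheorem8 : (n : ℕ) (σ : List ℕ) → IsPerm n σ →
    (e : List ℕ) → InE n e → hanMap e ≡ σ →
    IsSt e (exc σ)
mainTheorem8 n σ _ []       _                   refl = isSt-greedySt []
mainTheorem8 n σ _ (_ ∷ es) (_ , s≤s z≤n , es≤) refl =
  subst (IsSt (0 ∷ es)) (sym (exc-foldl-Ψ es [1]-injectiveWord es≤)) (isSt-greedySt (0 ∷ es))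
  where
  [1]-injectiveWord : InjectiveWord 1 (1 ∷ [])
  [1]-injectiveWord = ∷-injectiveWord (record { length≡ = refl ; unique = [] ; bounded = λ () })
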